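{- Let $k$ be a positive integer and $s>0$. There is a bijection between the set $\mathcal{FB}_{ -1}(s,k)$ and the set $\mathcal{B}^o(s,k)$.
   Context: A free ballot $(s,k)$-path of height $n$ is a lattice path from $(0,0)$ to $(s,n)$ using up steps $(k/2,1)$, down steps $(k/2,-1)$ and horizontal steps $(\ell,0)$ with $\ell$ an integer, $1\le\ell<k$ (it may go below the $x$-axis); $\mathcal{FB}_n(s,k)$ denotes the set of these. A ballot $(s,k)$-path of height $n$ is such a path that never lies below the $x$-axis. $\mathcal{B}^o(s,k)$ is the set of ballot $(s,k)$-paths of odd height (the height being any odd $n\ge1$). -}

module Defs where

open import Data.Nat using (ℕ; zero; suc; _+_; _*_; _≤_; _<_)
open import Data.Integer as ℤ using (ℤ; +_; -[1+_])
open import Data.List using (List; []; _∷_)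
open import Data.Product using (Σ; _×_)
open import Data.Unit using (⊤)
open import Relation.Binary.PropositionalEquality using (_≡_)

-- Convention: all x-coordinates are DOUBLED, so that they are natural numbers.
-- An up step (k/2,1) has doubled width k, a down step (k/2,-1) doubled width k,
-- a horizontal step (ℓ,0) with 1 ≤ ℓ < k has doubled width 2ℓ.

data Step (k : ℕ) : Set where
  up   : Step k
  down : Step k
  hor  : (ℓ : ℕ) → 1 ≤ ℓ → ℓ < k → Step k

width2 : {k : ℕ} → Step k → ℕ
width2 {k} up        = k
width2 {k} down      = k
width2 (hor ℓ _ _)   = 2 * ℓ

dh : {k : ℕ} → Step k → ℤ
dh up          = + 1
dh down        = -[1+ 0 ]
dh (hor _ _ _) = + 0

totalWidth2 : {k : ℕ} → List (Step k) → ℕ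
totalWidth2 []       = 0
totalWidth2 (x ∷ xs) = width2 x + totalWidth2 xs

height : {k : ℕ} → List (Step k) → ℤ
height []       = + 0
height (x ∷ xs) = dh x ℤ.+ height xs

-- the path, started at height h, never goes below the x-axis
-- (all vertices have height ≥ 0; since steps are straight segments between
-- integer heights this is the same as the path never lying below the axis)
StaysNonNeg : {k : ℕ} → ℤ → List (Step k) → Set
StaysNonNeg h []       = ⊤
StaysNonNeg h (x ∷ xs) = (+ 0 ℤ.≤ h ℤ.+ dh x) × StaysNonNeg (h ℤ.+ dh x) xs

-- FB_n(s,k), with t = 2s : free ballot (s,k)-paths of height n
FB : (k t : ℕ) → ℤ → Set
FB k t n = Σ (List (Step k)) λ p → (totalWidth2 p ≡ t) × (height p ≡ n)

B : (k t : ℕ) → ℤ → Set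
B k t n = Σ (List (Step k)) λ p →
  (totalWidth2 p ≡ t) × (height p ≡ n) × StaysNonNeg (+ 0) p

Bo : (k t : ℕ) → Set
Bo k t = Σ ℕ λ m → B k t (+ (suc (2 * m)))

-- A free ballot path of height -1 and a ballot path of odd height correspond by
-- "flipping new minima".  Scan a free path p, keeping d = (current height) - (running
-- minimum); every down step taken at d = 0 reaches a new minimum and is replaced by an up
-- step (flipFrom).  If p ends at height -1 with running minimum -L, exactly L steps are
-- flipped, the result is a ballot path of height 2L - 1, and its final gap g = L - 1
-- (height above the running minimum) gives the odd height 2g + 1.
--
-- Conversely (unflip), in a ballot path q the flipped steps are recognised as the up steps
-- after which q never returns to the starting level of the step; turning the first m + 1 of
-- them back into down steps inverts the flipping on paths of height 2m + 1.
module Submission where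

open import Defs
open import Data.Nat using (ℕ; _<_)
open import Data.Integer using (-[1+_])
open import Function.Bundles using (_⤖_)

open import Data.Nat using (zero; suc; _≤_; z≤n; s≤s)
import Data.Nat as ℕ
import Data.Nat.Properties as ℕₚ
open import Data.Integer using (ℤ; +_; _+_; _-_; _*_; +≤+)
import Data.Integer as ℤ
import Data.Integer.Properties as ℤₚ
open import Data.Integer.Tactic.RingSolver using (solve-∀)
open import Data.List using (List; []; _∷_)
open import Data.Product using (_×_; _,_; proj₁; proj₂; map; map₁)
open import Data.Unit using (⊤; tt)
open import Data.Empty using (⊥; ⊥-elim)
open import Relation.Nullary using (Dec; yes; no; ¬_; _×-dec_)
open import Relation.Binary.PropositionalEquality
open ≡-Reasoning
open import Axiom.UniquenessOfIdentityProofs using (module Decidable⇒UIP)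
open import Function.Bundles using (mk↔ₛ′)
open import Function.Properties.Inverse using (↔⇒⤖)

regroup : ∀ a h f → a + (h + + 2 * f) ≡ (a + h) + + 2 * f
regroup = solve-∀

lower : ∀ r d (h : ℤ) → + suc r ℤ.≤ + suc d + h → + r ℤ.≤ + d + h
lower r d h le = subst (+ r ℤ.≤_) (cancel (+ d) h) (ℤₚ.+-monoʳ-≤ -[1+ 0 ] le)
  where cancel : ∀ a h → -[1+ 0 ] + ((+ 1 + a) + h) ≡ a + h
        cancel = solve-∀

cancel-even : ∀ h a → h + + 2 * (+ 1 + a) ≡ + 1 + + 2 * a → h ≡ -[1+ 0 ]
cancel-even h a e = begin
  h                                       ≡⟨ drop h a ⟩
  (h + + 2 * (+ 1 + a)) - + 2 * (+ 1 + a) ≡⟨ cong (_- + 2 * (+ 1 + a)) e ⟩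
  (+ 1 + + 2 * a) - + 2 * (+ 1 + a)       ≡⟨ net a ⟩
  -[1+ 0 ]                                ∎
  where drop : ∀ h a → h ≡ (h + + 2 * (+ 1 + a)) - + 2 * (+ 1 + a)
        drop = solve-∀
        net : ∀ a → (+ 1 + + 2 * a) - + 2 * (+ 1 + a) ≡ -[1+ 0 ]
        net = solve-∀

ℤ-irrelevant : {a b : ℤ} (e e′ : a ≡ b) → e ≡ e′
ℤ-irrelevant = Decidable⇒UIP.≡-irrelevant ℤₚ._≟_

module _ {k : ℕ} where

  Path : Set
  Path = List (Step k)

  up-step : ∀ a → + a + dh {k} up ≡ + suc a
  up-step a = cong +_ (ℕₚ.+-comm a 1)

  hor-step : ∀ a {ℓ} (1≤ℓ : 1 ≤ ℓ) (ℓ<k : ℓ < k) → + a + dh (hor ℓ 1≤ℓ ℓ<k) ≡ + a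
  hor-step a _ _ = cong +_ (ℕₚ.+-identityʳ a)

  end-step : ∀ a x (xs : Path) → + a + height (x ∷ xs) ≡ (+ a + dh x) + height xs
  end-step a x xs = sym (ℤₚ.+-assoc (+ a) (dh x) (height xs))

  end-up : ∀ a (xs : Path) → + a + height (up ∷ xs) ≡ + suc a + height xs
  end-up a xs = trans (end-step a up xs) (cong (_+ height xs) (up-step a))

  end-hor : ∀ a {ℓ} (1≤ℓ : 1 ≤ ℓ) (ℓ<k : ℓ < k) (xs : Path) →
            + a + height (hor ℓ 1≤ℓ ℓ<k ∷ xs) ≡ + a + height xs
  end-hor a p q xs = trans (end-step a (hor _ p q) xs) (cong (_+ height xs) (hor-step a p q))

  stays-up : ∀ {a} {xs : Path} → StaysNonNeg (+ suc a) xs → StaysNonNeg (+ a) (up ∷ xs)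
  stays-up {a} {xs} s = +≤+ z≤n , subst (λ h → StaysNonNeg h xs) (sym (up-step a)) s

  stays-up⁻ : ∀ {a} {xs : Path} → StaysNonNeg (+ a) (up ∷ xs) → StaysNonNeg (+ suc a) xs
  stays-up⁻ {a} {xs} (_ , s) = subst (λ h → StaysNonNeg h xs) (up-step a) s

  stays-hor : ∀ {a ℓ} (1≤ℓ : 1 ≤ ℓ) (ℓ<k : ℓ < k) {xs : Path} →
              StaysNonNeg (+ a) xs → StaysNonNeg (+ a) (hor ℓ 1≤ℓ ℓ<k ∷ xs)
  stays-hor {a} p q {xs} s = +≤+ z≤n , subst (λ h → StaysNonNeg h xs) (sym (hor-step a p q)) s

  stays-hor⁻ : ∀ {a ℓ} (1≤ℓ : 1 ≤ ℓ) (ℓ<k : ℓ < k) {xs : Path} →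
               StaysNonNeg (+ a) (hor ℓ 1≤ℓ ℓ<k ∷ xs) → StaysNonNeg (+ a) xs
  stays-hor⁻ {a} p q {xs} (_ , s) = subst (λ h → StaysNonNeg h xs) (hor-step a p q) s

  stays-irrelevant : ∀ h (p : Path) (s s′ : StaysNonNeg h p) → s ≡ s′
  stays-irrelevant h []       tt       tt         = refl
  stays-irrelevant h (x ∷ xs) (le , s) (le′ , s′) =
    cong₂ _,_ (ℤₚ.≤-irrelevant le le′) (stays-irrelevant _ xs s s′)

  nonNeg? : ∀ h (p : Path) → Dec (StaysNonNeg h p)
  nonNeg? h []       = yes tt
  nonNeg? h (x ∷ xs) = (+ 0 ℤ.≤? h + dh x) ×-dec nonNeg? (h + dh x) xs

  -- Reaches d q: the path q, started d levels above some base level, visits the base level.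
  Reaches : ℕ → Path → Set
  Reaches zero    _                  = ⊤
  Reaches (suc d) []                 = ⊥
  Reaches (suc d) (up ∷ xs)          = Reaches (suc (suc d)) xs
  Reaches (suc d) (down ∷ xs)        = Reaches d xs
  Reaches (suc d) (hor _ _ _ ∷ xs)   = Reaches (suc d) xs

  reaches-bound : ∀ a d (q : Path) → StaysNonNeg (+ a) q → Reaches d q → d ≤ a
  reaches-bound a       zero    q                    s        r = z≤n
  reaches-bound a       (suc d) (up ∷ xs)            s        r =
    ℕₚ.≤-pred (reaches-bound (suc a) (suc (suc d)) xs (stays-up⁻ s) r)
  reaches-bound zero    (suc d) (down ∷ xs)          (() , _) r
  reaches-bound (suc a) (suc d) (down ∷ xs)          (_ , s)  r = s≤s (reaches-bound a d xs s r)
  reaches-bound a       (suc d) (hor _ p q ∷ xs)     s        r =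
    reaches-bound a (suc d) xs (stays-hor⁻ p q s) r

  -- flipFrom d p scans p keeping d = current height minus running minimum; a down step
  -- taken at d = 0 reaches a new minimum and is replaced by an up step.
  flipFrom : ℕ → Path → Path
  flipFrom d       []                 = []
  flipFrom d       (up ∷ xs)          = up ∷ flipFrom (suc d) xs
  flipFrom zero    (down ∷ xs)        = up ∷ flipFrom zero xs
  flipFrom (suc d) (down ∷ xs)        = down ∷ flipFrom d xs
  flipFrom d       (hor ℓ p q ∷ xs)   = hor ℓ p q ∷ flipFrom d xs

  flips : ℕ → Path → ℕ
  flips d       []                 = 0
  flips d       (up ∷ xs)          = flips (suc d) xs
  flips zero    (down ∷ xs)        = suc (flips zero xs)
  flips (suc d) (down ∷ xs)        = flips d xs
  flips d       (hor _ _ _ ∷ xs)   = flips d xs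

  gap : ℕ → Path → ℕ
  gap d       []                 = d
  gap d       (up ∷ xs)          = gap (suc d) xs
  gap zero    (down ∷ xs)        = gap zero xs
  gap (suc d) (down ∷ xs)        = gap d xs
  gap d       (hor _ _ _ ∷ xs)   = gap d xs

  flip-width : ∀ d (p : Path) → totalWidth2 (flipFrom d p) ≡ totalWidth2 p
  flip-width d       []                 = refl
  flip-width d       (up ∷ xs)          = cong (ℕ._+_ k) (flip-width (suc d) xs)
  flip-width zero    (down ∷ xs)        = cong (ℕ._+_ k) (flip-width zero xs)
  flip-width (suc d) (down ∷ xs)        = cong (ℕ._+_ k) (flip-width d xs)
  flip-width d       (hor ℓ _ _ ∷ xs)   = cong (ℕ._+_ (2 ℕ.* ℓ)) (flip-width d xs)

  flip-height : ∀ d (p : Path) → height (flipFrom d p) ≡ height p + + 2 * + flips d p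
  flip-height d [] = refl
  flip-height d (up ∷ xs) = begin
    + 1 + height (flipFrom (suc d) xs)             ≡⟨ cong (_+_ (+ 1)) (flip-height (suc d) xs) ⟩
    + 1 + (height xs + + 2 * + flips (suc d) xs)   ≡⟨ regroup (+ 1) (height xs) (+ flips (suc d) xs) ⟩
    (+ 1 + height xs) + + 2 * + flips (suc d) xs   ∎
  flip-height zero (down ∷ xs) = begin
    + 1 + height (flipFrom zero xs)                ≡⟨ cong (_+_ (+ 1)) (flip-height zero xs) ⟩
    + 1 + (height xs + + 2 * + flips zero xs)      ≡⟨ flipped (height xs) (+ flips zero xs) ⟩
    (-[1+ 0 ] + height xs) + + 2 * (+ 1 + + flips zero xs) ∎
    where flipped : ∀ h f → + 1 + (h + + 2 * f) ≡ (-[1+ 0 ] + h) + + 2 * (+ 1 + f)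
          flipped = solve-∀
  flip-height (suc d) (down ∷ xs) = begin
    -[1+ 0 ] + height (flipFrom d xs)              ≡⟨ cong (_+_ -[1+ 0 ]) (flip-height d xs) ⟩
    -[1+ 0 ] + (height xs + + 2 * + flips d xs)    ≡⟨ regroup -[1+ 0 ] (height xs) (+ flips d xs) ⟩
    (-[1+ 0 ] + height xs) + + 2 * + flips d xs    ∎
  flip-height d (hor _ _ _ ∷ xs) = begin
    + 0 + height (flipFrom d xs)                   ≡⟨ cong (_+_ (+ 0)) (flip-height d xs) ⟩
    + 0 + (height xs + + 2 * + flips d xs)         ≡⟨ regroup (+ 0) (height xs) (+ flips d xs) ⟩
    (+ 0 + height xs) + + 2 * + flips d xs         ∎

  flip-gap : ∀ d (p : Path) → + gap d p ≡ + d + height p + + flips d p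
  flip-gap d [] = sym (trans (ℤₚ.+-identityʳ (+ d + + 0)) (ℤₚ.+-identityʳ (+ d)))
  flip-gap d (up ∷ xs) = begin
    + gap (suc d) xs                               ≡⟨ flip-gap (suc d) xs ⟩
    (+ 1 + + d) + height xs + + flips (suc d) xs   ≡⟨ up-shift (+ d) (height xs) (+ flips (suc d) xs) ⟩
    + d + (+ 1 + height xs) + + flips (suc d) xs   ∎
    where up-shift : ∀ a h f → (+ 1 + a) + h + f ≡ a + (+ 1 + h) + f
          up-shift = solve-∀
  flip-gap zero (down ∷ xs) = begin
    + gap zero xs                                  ≡⟨ flip-gap zero xs ⟩
    + 0 + height xs + + flips zero xs              ≡⟨ new-min (height xs) (+ flips zero xs) ⟩
    + 0 + (-[1+ 0 ] + height xs) + (+ 1 + + flips zero xs) ∎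
    where new-min : ∀ h f → + 0 + h + f ≡ + 0 + (-[1+ 0 ] + h) + (+ 1 + f)
          new-min = solve-∀
  flip-gap (suc d) (down ∷ xs) = begin
    + gap d xs                                     ≡⟨ flip-gap d xs ⟩
    + d + height xs + + flips d xs                 ≡⟨ down-shift (+ d) (height xs) (+ flips d xs) ⟩
    (+ 1 + + d) + (-[1+ 0 ] + height xs) + + flips d xs ∎
    where down-shift : ∀ a h f → a + h + f ≡ (+ 1 + a) + (-[1+ 0 ] + h) + f
          down-shift = solve-∀
  flip-gap d (hor _ _ _ ∷ xs) = begin
    + gap d xs                                     ≡⟨ flip-gap d xs ⟩
    + d + height xs + + flips d xs                 ≡⟨ cong (λ h → + d + h + + flips d xs) (sym (ℤₚ.+-identityˡ (height xs))) ⟩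
    + d + (+ 0 + height xs) + + flips d xs         ∎

  -- Started at any height a ≥ d, the flipped path never goes below the axis: it only
  -- descends while above the running minimum, which lies at height a - d or higher.
  flip-nonNeg : ∀ a d (p : Path) → d ≤ a → StaysNonNeg (+ a) (flipFrom d p)
  flip-nonNeg a       d       []                 d≤a       = tt
  flip-nonNeg a       d       (up ∷ xs)          d≤a       = stays-up (flip-nonNeg (suc a) (suc d) xs (s≤s d≤a))
  flip-nonNeg a       zero    (down ∷ xs)        _         = stays-up (flip-nonNeg (suc a) zero xs z≤n)
  flip-nonNeg (suc a) (suc d) (down ∷ xs)        (s≤s d≤a) = +≤+ z≤n , flip-nonNeg a d xs d≤a
  flip-nonNeg a       d       (hor _ p q ∷ xs)   d≤a       = stays-hor p q (flip-nonNeg a d xs d≤a)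

  flip-reaches : ∀ d (p : Path) → 0 < flips d p → Reaches d (flipFrom d p)
  flip-reaches zero    p                  _   = tt
  flip-reaches (suc d) []                 ()
  flip-reaches (suc d) (up ∷ xs)          pos = flip-reaches (suc (suc d)) xs pos
  flip-reaches (suc d) (down ∷ xs)        pos = flip-reaches d xs pos
  flip-reaches (suc d) (hor _ _ _ ∷ xs)   pos = flip-reaches (suc d) xs pos

  ¬reaches : ∀ d (q : Path) → StaysNonNeg (+ 0) q → ¬ Reaches (suc d) q
  ¬reaches d q s r with reaches-bound 0 (suc d) q s r
  ... | ()

  dips-reach : ∀ a (q : Path) → ¬ StaysNonNeg (+ a) q → Reaches (suc a) q
  dips-reach a       []                 ¬s = ⊥-elim (¬s tt)
  dips-reach a       (up ∷ xs)          ¬s = dips-reach (suc a) xs (λ s → ¬s (stays-up s))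
  dips-reach zero    (down ∷ xs)        ¬s = tt
  dips-reach (suc a) (down ∷ xs)        ¬s = dips-reach a xs (λ s → ¬s (+≤+ z≤n , s))
  dips-reach a       (hor _ p q ∷ xs)   ¬s = dips-reach a xs (λ s → ¬s (stays-hor p q s))

  -- unflip r q turns back into down steps the first r up steps of q after which q never
  -- returns to the starting level of that step.
  unflip : ℕ → Path → Path
  unflip r       []                 = []
  unflip r       (down ∷ xs)        = down ∷ unflip r xs
  unflip r       (hor ℓ p q ∷ xs)   = hor ℓ p q ∷ unflip r xs
  unflip zero    (up ∷ xs)          = up ∷ unflip zero xs
  unflip (suc r) (up ∷ xs) with nonNeg? (+ 0) xs
  ... | yes _ = down ∷ unflip r xs
  ... | no  _ = up ∷ unflip (suc r) xs

  unflip-zero : ∀ (q : Path) → unflip 0 q ≡ q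
  unflip-zero []                 = refl
  unflip-zero (up ∷ xs)          = cong (up ∷_) (unflip-zero xs)
  unflip-zero (down ∷ xs)        = cong (down ∷_) (unflip-zero xs)
  unflip-zero (hor ℓ p q ∷ xs)   = cong (hor ℓ p q ∷_) (unflip-zero xs)

  unflip-width : ∀ r (q : Path) → totalWidth2 (unflip r q) ≡ totalWidth2 q
  unflip-width r       []                 = refl
  unflip-width zero    (up ∷ xs)          = cong (ℕ._+_ k) (unflip-width zero xs)
  unflip-width (suc r) (up ∷ xs) with nonNeg? (+ 0) xs
  ... | yes _ = cong (ℕ._+_ k) (unflip-width r xs)
  ... | no  _ = cong (ℕ._+_ k) (unflip-width (suc r) xs)
  unflip-width r       (down ∷ xs)        = cong (ℕ._+_ k) (unflip-width r xs)
  unflip-width r       (hor ℓ _ _ ∷ xs)   = cong (ℕ._+_ (2 ℕ.* ℓ)) (unflip-width r xs)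

  -- Unflipping the flips of a path recovers it: each flipped step is exactly such an up
  -- step, since afterwards the flipped path stays above the new minimum.
  unflip-flip : ∀ d (p : Path) → unflip (flips d p) (flipFrom d p) ≡ p
  unflip-flip d [] = refl
  unflip-flip d (up ∷ xs)
    with flips (suc d) xs | unflip-flip (suc d) xs | flip-reaches (suc d) xs
  ... | zero  | ih | _ = cong (up ∷_) ih
  ... | suc r | ih | reach with nonNeg? (+ 0) (flipFrom (suc d) xs)
  ...   | yes s = ⊥-elim (¬reaches d _ s (reach (s≤s z≤n)))
  ...   | no  _ = cong (up ∷_) ih
  unflip-flip zero (down ∷ xs) with nonNeg? (+ 0) (flipFrom zero xs)
  ... | yes _ = cong (down ∷_) (unflip-flip zero xs)
  ... | no ¬s = ⊥-elim (¬s (flip-nonNeg 0 0 xs z≤n))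
  unflip-flip (suc d) (down ∷ xs)      = cong (down ∷_) (unflip-flip d xs)
  unflip-flip d (hor ℓ p q ∷ xs)       = cong (hor ℓ p q ∷_) (unflip-flip d xs)

  flip-fixed : ∀ d (q : Path) → StaysNonNeg (+ d) q → flipFrom d q ≡ q × flips d q ≡ 0
  flip-fixed d       []                 s        = refl , refl
  flip-fixed d       (up ∷ xs)          s        = map₁ (cong (up ∷_)) (flip-fixed (suc d) xs (stays-up⁻ s))
  flip-fixed zero    (down ∷ xs)        (() , _)
  flip-fixed (suc d) (down ∷ xs)        (_ , s)  = map₁ (cong (down ∷_)) (flip-fixed d xs s)
  flip-fixed d       (hor ℓ p q ∷ xs)   s        =
    map₁ (cong (hor ℓ p q ∷_)) (flip-fixed d xs (stays-hor⁻ p q s))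

  flip-unflip : ∀ r d (q : Path) → StaysNonNeg (+ d) q → Reaches d q → + r ℤ.≤ + d + height q →
                flipFrom d (unflip r q) ≡ q × flips d (unflip r q) ≡ r
  flip-unflip zero d q s _ _ rewrite unflip-zero q = flip-fixed d q s
  flip-unflip (suc r) zero    []        _ _     (+≤+ ())
  flip-unflip (suc r) (suc d) []        _ ()    _
  flip-unflip (suc r) d       (up ∷ xs) s reach le with nonNeg? (+ 0) xs
  flip-unflip (suc r) zero    (up ∷ xs) s reach le | yes s₀ =
    map (cong (up ∷_)) (cong suc)
      (flip-unflip r zero xs s₀ tt (lower r 0 (height xs) (subst (+ suc r ℤ.≤_) (end-up 0 xs) le)))
  flip-unflip (suc r) (suc d) (up ∷ xs) s reach le | yes s₀ = ⊥-elim (¬reaches (suc d) xs s₀ reach)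
  flip-unflip (suc r) d       (up ∷ xs) s reach le | no ¬s₀ =
    map₁ (cong (up ∷_))
      (flip-unflip (suc r) (suc d) xs (stays-up⁻ s) (reach-up d reach)
        (subst (+ suc r ℤ.≤_) (end-up d xs) le))
    where reach-up : ∀ d → Reaches d (up ∷ xs) → Reaches (suc d) xs
          reach-up zero    _ = dips-reach 0 xs ¬s₀
          reach-up (suc d) r = r
  flip-unflip (suc r) zero    (down ∷ xs) (() , _) _ _
  flip-unflip (suc r) (suc d) (down ∷ xs) (_ , s) reach le =
    map₁ (cong (down ∷_)) (flip-unflip (suc r) d xs s reach (subst (+ suc r ℤ.≤_) (end-step (suc d) down xs) le))
  flip-unflip (suc r) d       (hor ℓ p q ∷ xs) s reach le =
    map₁ (cong (hor ℓ p q ∷_))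
      (flip-unflip (suc r) d xs (stays-hor⁻ p q s) (reach-hor d reach)
        (subst (+ suc r ℤ.≤_) (end-hor d p q xs) le))
    where reach-hor : ∀ d → Reaches d (hor ℓ p q ∷ xs) → Reaches d xs
          reach-hor zero    _ = tt
          reach-hor (suc d) r = r

  flip-dip : ∀ (p : Path) → height p ≡ -[1+ 0 ] →
             flips 0 p ≡ suc (gap 0 p) × height (flipFrom 0 p) ≡ + suc (2 ℕ.* gap 0 p)
  flip-dip p hp = flips≡ , height≡
    where
    g f : ℕ
    g = gap 0 p
    f = flips 0 p
    gap≡ : + g ≡ + 0 + -[1+ 0 ] + + f
    gap≡ = trans (flip-gap 0 p) (cong (λ h → + 0 + h + + f) hp)
    flips≡ : f ≡ suc g
    flips≡ = ℤₚ.+-injective (begin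
      + f                               ≡⟨ undo (+ f) ⟩
      + 1 + (+ 0 + -[1+ 0 ] + + f)      ≡⟨ cong (_+_ (+ 1)) (sym gap≡) ⟩
      + suc g                           ∎)
      where undo : ∀ a → a ≡ + 1 + (+ 0 + -[1+ 0 ] + a)
            undo = solve-∀
    height≡ : height (flipFrom 0 p) ≡ + suc (2 ℕ.* g)
    height≡ = begin
      height (flipFrom 0 p)             ≡⟨ flip-height 0 p ⟩
      height p + + 2 * + f              ≡⟨ cong₂ (λ h n → h + + 2 * + n) hp flips≡ ⟩
      -[1+ 0 ] + + 2 * (+ 1 + + g)      ≡⟨ odd (+ g) ⟩
      + 1 + + 2 * + g                   ≡⟨ cong (_+_ (+ 1)) (sym (ℤₚ.pos-* 2 g)) ⟩
      + suc (2 ℕ.* g)                   ∎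
      where odd : ∀ a → -[1+ 0 ] + + 2 * (+ 1 + a) ≡ + 1 + + 2 * a
            odd = solve-∀

  unflip-odd : ∀ m (q : Path) → StaysNonNeg (+ 0) q → height q ≡ + suc (2 ℕ.* m) →
               flipFrom 0 (unflip (suc m) q) ≡ q × height (unflip (suc m) q) ≡ -[1+ 0 ] ×
               gap 0 (unflip (suc m) q) ≡ m
  unflip-odd m q s hq = flip≡ , height≡ , ℤₚ.+-injective gap≡
    where
    p = unflip (suc m) q
    recovered : flipFrom 0 p ≡ q × flips 0 p ≡ suc m
    recovered = flip-unflip (suc m) 0 q s tt
                  (subst (+ suc m ℤ.≤_) (sym (trans (ℤₚ.+-identityˡ (height q)) hq)) (+≤+ (s≤s (ℕₚ.m≤m+n m (m ℕ.+ 0)))))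
    flip≡ : flipFrom 0 p ≡ q
    flip≡ = proj₁ recovered
    height≡ : height p ≡ -[1+ 0 ]
    height≡ = cancel-even (height p) (+ m) (begin
      height p + + 2 * (+ 1 + + m)   ≡⟨ cong (λ n → height p + + 2 * + n) (sym (proj₂ recovered)) ⟩
      height p + + 2 * + flips 0 p   ≡⟨ sym (flip-height 0 p) ⟩
      height (flipFrom 0 p)          ≡⟨ cong height flip≡ ⟩
      height q                       ≡⟨ hq ⟩
      + suc (2 ℕ.* m)                ≡⟨ cong (_+_ (+ 1)) (ℤₚ.pos-* 2 m) ⟩
      + 1 + + 2 * + m                ∎)
    gap≡ : + gap 0 p ≡ + m
    gap≡ = trans (flip-gap 0 p) (cong₂ (λ h n → + 0 + h + + n) height≡ (proj₂ recovered))

module _ (k t : ℕ) where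

  FB-≡ : ∀ {n} {x y : FB k t n} → proj₁ x ≡ proj₁ y → x ≡ y
  FB-≡ {x = p , w , h} {y = .p , w′ , h′} refl =
    cong₂ (λ a b → p , a , b) (ℕₚ.≡-irrelevant w w′) (ℤ-irrelevant h h′)

  Bo-≡ : ∀ {x y : Bo k t} → proj₁ x ≡ proj₁ y → proj₁ (proj₂ x) ≡ proj₁ (proj₂ y) → x ≡ y
  Bo-≡ {x = m , q , w , h , s} {y = .m , .q , w′ , h′ , s′} refl refl =
    cong (λ z → m , q , z)
      (cong₂ _,_ (ℕₚ.≡-irrelevant w w′) (cong₂ _,_ (ℤ-irrelevant h h′) (stays-irrelevant _ q s s′)))

  dipToOdd : FB k t -[1+ 0 ] → Bo k t
  dipToOdd (p , w , h) =
    gap 0 p , flipFrom 0 p , trans (flip-width 0 p) w , proj₂ (flip-dip p h) , flip-nonNeg 0 0 p z≤n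

  oddToDip : Bo k t → FB k t -[1+ 0 ]
  oddToDip (m , q , w , h , s) =
    unflip (suc m) q , trans (unflip-width (suc m) q) w , proj₁ (proj₂ (unflip-odd m q s h))

  dipToOdd∘oddToDip : ∀ y → dipToOdd (oddToDip y) ≡ y
  dipToOdd∘oddToDip (m , q , w , h , s) =
    Bo-≡ (proj₂ (proj₂ (unflip-odd m q s h))) (proj₁ (unflip-odd m q s h))

  oddToDip∘dipToOdd : ∀ x → oddToDip (dipToOdd x) ≡ x
  oddToDip∘dipToOdd (p , w , h) = FB-≡ (begin
    unflip (suc (gap 0 p)) (flipFrom 0 p)   ≡⟨ cong (λ r → unflip r (flipFrom 0 p)) (sym (proj₁ (flip-dip p h))) ⟩
    unflip (flips 0 p) (flipFrom 0 p)       ≡⟨ unflip-flip 0 p ⟩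
    p                                       ∎)

theorem2p17 : (k t : ℕ) → 0 < k → 0 < t → FB k t -[1+ 0 ] ⤖ Bo k t
theorem2p17 k t _ _ =
  ↔⇒⤖ (mk↔ₛ′ (dipToOdd k t) (oddToDip k t) (dipToOdd∘oddToDip k t) (oddToDip∘dipToOdd k t))
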